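{- Let \(T\) be an inductive rank decomposition of \(\Gamma = (G,B)\) with \(G \in \mathrm{Mat}_{\mathbb{N}}(k,k)\) and \(B \in \mathrm{Mat}_{\mathbb{N}}(k,n)\). Then there is a rank decomposition \((Y,r)\) of \(G\) such that \(\mathrm{width}(Y,r) \leq \mathrm{width}(T)\).
   Context: A graph with dangling edges \(\Gamma = (G,B)\) consists of an adjacency matrix \(G \in \mathrm{Mat}_{\mathbb{N}}(k,k)\) of a graph on \(k\) vertices (taken up to the equivalence \([G]=[H]\) iff \(G + G^{T} = H + H^{T}\)) and a matrix \(B \in \mathrm{Mat}_{\mathbb{N}}(k,n)\) recording dangling edges from the vertices to \(n\) boundary ports. A rank decomposition \((Y,r)\) of a graph \(G\) is a subcubic tree \(Y\) with a bijection \(r\) from the leaves of \(Y\) to the vertices of \(G\). Each edge \(b\) of \(Y\) gives a 2-partition \(\{A_b,B_b\}\) of the vertices of \(G\); with \(X_b\) the matrix counting edges of \(G\) between \(A_b\) and \(B_b\), the order of \(b\) is \(\operatorname{rank}(X_b)\) and \(\mathrm{width}(Y,r)\) is the maximum order of an edge of \(Y\). An inductive rank decomposition of \(\Gamma\) is a binary tree whose nodes are labelled by nonempty subgraphs of \(\Gamma\) such that either \(\Gamma\) is empty and \(T\) is empty; or \(\Gamma\) has one vertex and \(T\) is a leaf labelled \(\Gamma\); or \(T\) has root \(\Gamma\) and subtrees \(T_1,T_2\) that are inductive rank decompositions of subgraphs \(\Gamma_i = (G_i,B_i)\) with \([G] = \left[\begin{pmatrix} G_1 & C \\ 0 & G_2\end{pmatrix}\right]\),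 \(B = \begin{pmatrix} A_1 \\ A_2\end{pmatrix}\), \(B_1 = (A_1 \mid C)\), \(B_2 = (A_2 \mid C^{T})\). Its width is \(0\) for the empty tree and \(\max\{\mathrm{width}(T_1), \mathrm{width}(T_2), \operatorname{rank}(B)\}\) otherwise. -}

module Defs where

open import Data.Nat using (ℕ; zero; suc; _≤_) renaming (_+_ to _+ℕ_)
open import Data.Bool using (Bool; true; false; _∧_; not; if_then_else_)
open import Data.Fin using (Fin; zero; suc; splitAt)
open import Data.Fin.Subset using (∣_∣)
open import Data.Vec using (tabulate)
open import Data.Sum using (_⊎_; inj₁; inj₂; [_,_]′)
open import Data.Product using (Σ; _×_; _,_; proj₁)
open import Data.Unit using (⊤)
open import Data.Integer using (+_)
open import Data.Rational using (ℚ; _/_; 0ℚ; _+_; _*_)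
open import Relation.Nullary using (¬_)
open import Relation.Binary.PropositionalEquality using (_≡_)
open import Function.Bundles using (_⤖_; _⇔_; Bijection)

Mat : Set → ℕ → ℕ → Set
Mat A m n = Fin m → Fin n → A

_ᵀ : ∀ {A : Set} {m n} → Mat A m n → Mat A n m
(M ᵀ) i j = M j i

toℚ : ∀ {m n} → Mat ℕ m n → Mat ℚ m n
toℚ M i j = + (M i j) / 1

sumℚ : ∀ {n} → (Fin n → ℚ) → ℚ
sumℚ {zero}  f = 0ℚ
sumℚ {suc n} f = f zero + sumℚ (λ l → f (suc l))

-- rank(X) ≤ w : the column space of X (over ℚ) is spanned by w vectors,
-- i.e. X = P Q with P : m × w and Q : w × n.
RankLe : ∀ {m n} → Mat ℚ m n → ℕ → Set
RankLe {m} {n} X w =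
  Σ (Mat ℚ m w) λ P → Σ (Mat ℚ w n) λ Q →
    ∀ i j → X i j ≡ sumℚ (λ l → P i l * Q l j)

upperBlock : ∀ {k₁ k₂} → Mat ℕ k₁ k₁ → Mat ℕ k₁ k₂ → Mat ℕ k₂ k₂ →
             Mat ℕ (k₁ +ℕ k₂) (k₁ +ℕ k₂)
upperBlock {k₁} {k₂} G₁ C G₂ i j with splitAt k₁ i | splitAt k₁ j
... | inj₁ a | inj₁ b = G₁ a b
... | inj₁ a | inj₂ b = C a b
... | inj₂ a | inj₁ b = 0
... | inj₂ a | inj₂ b = G₂ a b

stack : ∀ {k₁ k₂ n} → Mat ℕ k₁ n → Mat ℕ k₂ n → Mat ℕ (k₁ +ℕ k₂) n
stack {k₁} A₁ A₂ i j = [ (λ a → A₁ a j) , (λ a → A₂ a j) ]′ (splitAt k₁ i)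

beside : ∀ {k n p} → Mat ℕ k n → Mat ℕ k p → Mat ℕ k (n +ℕ p)
beside {n = n} A C i j = [ (λ b → A i b) , (λ b → C i b) ]′ (splitAt n j)

SameGraph : ∀ {k} → Mat ℕ k k → Mat ℕ k k → Set
SameGraph G H = ∀ i j → G i j +ℕ G j i ≡ H i j +ℕ H j i

-- Every node is labelled by a nonempty
-- subgraph, so both children of an internal node are nonempty.

data IRD : (k n : ℕ) → Mat ℕ k k → Mat ℕ k n → Set where
  empty : ∀ {n} {G : Mat ℕ 0 0} {B : Mat ℕ 0 n} → IRD 0 n G B
  leaf  : ∀ {n} {G : Mat ℕ 1 1} {B : Mat ℕ 1 n} → IRD 1 n G B
  node  : ∀ {k₁ k₂ n} {G : Mat ℕ (suc k₁ +ℕ suc k₂) (suc k₁ +ℕ suc k₂)}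
            {B : Mat ℕ (suc k₁ +ℕ suc k₂) n}
            (G₁ : Mat ℕ (suc k₁) (suc k₁)) (G₂ : Mat ℕ (suc k₂) (suc k₂))
            (C : Mat ℕ (suc k₁) (suc k₂))
            (A₁ : Mat ℕ (suc k₁) n) (A₂ : Mat ℕ (suc k₂) n) →
            SameGraph G (upperBlock G₁ C G₂) →
            (∀ i j → B i j ≡ stack A₁ A₂ i j) →
            IRD (suc k₁) (n +ℕ suc k₂) G₁ (beside A₁ C) →
            IRD (suc k₂) (n +ℕ suc k₁) G₂ (beside A₂ (C ᵀ)) →
            IRD (suc k₁ +ℕ suc k₂) n G B

IRDWidthLe : ∀ {k n G B} → IRD k n G B → ℕ → Set
IRDWidthLe empty w = ⊤
IRDWidthLe {B = B} leaf w = RankLe (toℚ B) w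
IRDWidthLe {B = B} (node _ _ _ _ _ _ _ T₁ T₂) w =
  IRDWidthLe T₁ w × IRDWidthLe T₂ w × RankLe (toℚ B) w

record SimpleGraph : Set where
  field
    size  : ℕ
    adj   : Fin size → Fin size → Bool
    sym   : ∀ x y → adj x y ≡ adj y x
    irrefl : ∀ x → adj x x ≡ false

module _ (Y : SimpleGraph) where
  open SimpleGraph Y

  degree : Fin size → ℕ
  degree v = ∣ tabulate (adj v) ∣

  data Walk (ok : Fin size → Fin size → Set) : Fin size → Fin size → Set where
    here : ∀ {x} → Walk ok x x
    step : ∀ {x y z} → ok x y → Walk ok y z → Walk ok x z

  Edge : Fin size → Fin size → Set
  Edge x y = adj x y ≡ true

  SameEdge : (x y u v : Fin size) → Set
  SameEdge x y u v = (x ≡ u × y ≡ v) ⊎ (x ≡ v × y ≡ u)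

  Avoiding : Fin size → Fin size → Fin size → Fin size → Set
  Avoiding u v x y = Edge x y × ¬ SameEdge x y u v

  Connected : Set
  Connected = ∀ x y → Walk Edge x y

  -- acyclic: no edge {u,v} lies on a cycle, i.e. u and v are not joined
  -- by a walk avoiding that edge
  Acyclic : Set
  Acyclic = ∀ u v → Edge u v → ¬ Walk (Avoiding u v) u v

  IsSubcubicTree : Set
  IsSubcubicTree = Connected × Acyclic × (∀ v → degree v ≤ 3)

  -- leaves (a vertex of degree ≤ 1; covers the one-vertex tree)
  Leaf : Set
  Leaf = Σ (Fin size) λ v → degree v ≤ 1

record RankDecomposition {k : ℕ} (G : Mat ℕ k k) : Set where
  field
    tree   : SimpleGraph
    isTree : IsSubcubicTree tree
    r      : Leaf tree ⤖ Fin k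

-- the matrix X counting edges of G between the sides A = χ⁻¹(true) and
-- B = χ⁻¹(false), padded with zero rows/columns to a k × k matrix
cutMatrix : ∀ {k} → Mat ℕ k k → (Fin k → Bool) → Mat ℚ k k
cutMatrix G χ i j = if χ i ∧ not (χ j) then + (G i j +ℕ G j i) / 1 else 0ℚ

-- The side is given by its characteristic
-- function χ (which is uniquely determined by this condition).
RDWidthLe : ∀ {k} {G : Mat ℕ k k} → RankDecomposition G → ℕ → Set
RDWidthLe {k} {G} D w =
  ∀ u v → Edge tree u v →
  ∀ (χ : Fin k → Bool) →
  (∀ (ℓ : Leaf tree) → (χ (Bijection.to r ℓ) ≡ true) ⇔ Walk tree (Avoiding tree u v) (proj₁ ℓ) u) →
  RankLe (cutMatrix G χ) w
  where open RankDecomposition D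

-- A leaf becomes the one-vertex tree; at a node, the trees of
-- the two children are joined by a new root adjacent to both old roots. Old roots have degree 0
-- or 2, so the result is still subcubic and its leaves are exactly those of the two subtrees,
-- i.e. the vertices of G.
--
-- For the width, orient a tree edge uv so that the root is not on the u-side. The leaves on the
-- u-side are the vertices of the subgraph labelling a node of T, and the matrix of dangling edges
-- of that subgraph (boundaryMatrix) is, up to zero rows and a reindexing of columns, the matrix
-- B′ of that node, whose rank is at most width(T). The cut matrix X_uv consists of columns of it;
-- for the opposite orientation one takes the complementary side and transposes.
module Submission where

open import Defs
open import Data.Nat using (ℕ; zero; suc; _+_; _≤_; z≤n; s≤s)
open import Data.Nat.Properties using (≤-irrelevant; ≤-trans; m≤n+m; +-comm; +-identityʳ)
open import Data.Bool using (Bool; true; false; not; if_then_else_)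
open import Data.Bool.Properties using (∧-identityʳ; ¬-not; not-¬)
open import Data.Fin using (Fin; zero; suc; splitAt; join; _↑ˡ_; _↑ʳ_)
open import Data.Fin.Properties using (_≟_; splitAt-↑ˡ; splitAt-↑ʳ; splitAt⁻¹-↑ˡ; splitAt⁻¹-↑ʳ; join-splitAt)
open import Data.Fin.Subset using (∣_∣)
open import Data.Vec using (tabulate; _∷_; [])
open import Data.Vec.Properties using (tabulate-cong)
open import Data.Maybe using (Maybe; just; nothing; maybe′)
open import Data.Sum using (_⊎_; inj₁; inj₂; [_,_]′)
import Data.Sum as Sum
open import Data.Product using (Σ; _,_; proj₁; proj₂)
open import Data.Empty using (⊥; ⊥-elim)
import Data.Integer as ℤ
open import Data.Rational using (ℚ; _/_; 0ℚ) renaming (_+_ to _+ℚ_; _*_ to _*ℚ_)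
import Data.Rational.Properties as ℚ
open import Function using (_∘_; id)
open import Function.Bundles using (_⤖_; _⇔_; mk⤖; mk⇔; Equivalence; Bijection)
open import Relation.Nullary using (¬_; yes; no; does)
open import Relation.Nullary.Decidable using (dec-true; dec-false)
open import Relation.Binary.PropositionalEquality
open ≡-Reasoning
open Equivalence using (to; from)

module _ {Y : SimpleGraph} where
  open SimpleGraph Y using (size)

  infixr 5 _++ʷ_
  _++ʷ_ : ∀ {ok : Fin size → Fin size → Set} {x y z} →
          Walk Y ok x y → Walk Y ok y z → Walk Y ok x z
  here     ++ʷ q = q
  step e p ++ʷ q = step e (p ++ʷ q)

  walk-invariant : ∀ {A : Set} {ok : Fin size → Fin size → Set} (f : Fin size → A) →
                   (∀ {x y} → ok x y → f x ≡ f y) → ∀ {x y} → Walk Y ok x y → f x ≡ f y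
  walk-invariant f h here       = refl
  walk-invariant f h (step e p) = trans (h e) (walk-invariant f h p)

  Edge-sym : ∀ {x y} → Edge Y x y → Edge Y y x
  Edge-sym {x} {y} e = trans (SimpleGraph.sym Y y x) e

  SameEdge-source : ∀ {x y u v} → SameEdge Y x y u v → x ≡ u ⊎ x ≡ v
  SameEdge-source (inj₁ (p , _)) = inj₁ p
  SameEdge-source (inj₂ (p , _)) = inj₂ p

  SameEdge-swap : ∀ {x y u v} → SameEdge Y x y u v → SameEdge Y x y v u
  SameEdge-swap (inj₁ (p , q)) = inj₂ (p , q)
  SameEdge-swap (inj₂ (p , q)) = inj₁ (p , q)

  SameEdge-reverse : ∀ {x y u v} → SameEdge Y x y u v → SameEdge Y y x u v
  SameEdge-reverse (inj₁ (p , q)) = inj₂ (q , p)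
  SameEdge-reverse (inj₂ (p , q)) = inj₁ (q , p)

  Avoiding-swap : ∀ {u v x y} → Avoiding Y u v x y → Avoiding Y v u x y
  Avoiding-swap (e , ¬s) = e , ¬s ∘ SameEdge-swap

  Avoiding-reverse : ∀ {u v x y} → Avoiding Y u v x y → Avoiding Y u v y x
  Avoiding-reverse (e , ¬s) = Edge-sym e , ¬s ∘ SameEdge-reverse

  reverseWalk : ∀ {ok : Fin size → Fin size → Set} → (∀ {x y} → ok x y → ok y x) →
                ∀ {x y} → Walk Y ok x y → Walk Y ok y x
  reverseWalk sym here       = here
  reverseWalk sym (step s p) = reverseWalk sym p ++ʷ step (sym s) here

  reaches-endpoint : ∀ u v {x} → Walk Y (Edge Y) x u →
                     Walk Y (Avoiding Y u v) x u ⊎ Walk Y (Avoiding Y u v) x v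
  reaches-endpoint u v here = inj₁ here
  reaches-endpoint u v {x} (step e p) with x ≟ u | x ≟ v
  ... | yes refl | _        = inj₁ here
  ... | no _     | yes refl = inj₂ here
  ... | no x≢u   | no x≢v   = Sum.map (step (e , x∉uv)) (step (e , x∉uv)) (reaches-endpoint u v p)
    where x∉uv : ¬ SameEdge Y x _ u v
          x∉uv = [ x≢u , x≢v ]′ ∘ SameEdge-source

  reverseEdgeWalk : ∀ {x y} → Walk Y (Edge Y) x y → Walk Y (Edge Y) y x
  reverseEdgeWalk = reverseWalk (λ {x} {y} → Edge-sym {x} {y})

  sides-disjoint : Acyclic Y → ∀ {u v x} → Edge Y u v →
                   Walk Y (Avoiding Y u v) x u → Walk Y (Avoiding Y u v) x v → ⊥
  sides-disjoint acyclic {u} {v} e p q = acyclic u v e (reverseWalk Avoiding-reverse p ++ʷ q)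

module _ {Y Z : SimpleGraph} where
  open SimpleGraph Y using () renaming (size to m)
  open SimpleGraph Z using () renaming (size to n)

  collapseWalk : ∀ {ok : Fin m → Fin m → Set} {ok′ : Fin n → Fin n → Set} (f : Fin m → Fin n) →
                 (∀ {x y} → ok x y → f x ≡ f y ⊎ ok′ (f x) (f y)) →
                 ∀ {x y} → Walk Y ok x y → Walk Z ok′ (f x) (f y)
  collapseWalk f h here = here
  collapseWalk f h (step s p) with h s
  ... | inj₁ fx≡fy rewrite fx≡fy = collapseWalk f h p
  ... | inj₂ s′    = step s′ (collapseWalk f h p)

  SameEdge-map : ∀ (f : Fin m → Fin n) {x y u v} → SameEdge Y x y u v → SameEdge Z (f x) (f y) (f u) (f v)
  SameEdge-map f (inj₁ (p , q)) = inj₁ (cong f p , cong f q)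
  SameEdge-map f (inj₂ (p , q)) = inj₂ (cong f p , cong f q)

  SameEdge-unmap : ∀ (f : Fin m → Fin n) → (∀ {x y} → f x ≡ f y → x ≡ y) →
                   ∀ {x y u v} → SameEdge Z (f x) (f y) (f u) (f v) → SameEdge Y x y u v
  SameEdge-unmap f injective (inj₁ (p , q)) = inj₁ (injective p , injective q)
  SameEdge-unmap f injective (inj₂ (p , q)) = inj₂ (injective p , injective q)

  mapWalk : ∀ {ok : Fin m → Fin m → Set} {ok′ : Fin n → Fin n → Set} (f : Fin m → Fin n) →
            (∀ {x y} → ok x y → ok′ (f x) (f y)) →
            ∀ {x y} → Walk Y ok x y → Walk Z ok′ (f x) (f y)
  mapWalk f h = collapseWalk f (inj₂ ∘ h)

module _ {Y : SimpleGraph} where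
  swapAvoided : ∀ {u v x y} → Walk Y (Avoiding Y u v) x y → Walk Y (Avoiding Y v u) x y
  swapAvoided = mapWalk {Y = Y} {Z = Y} id (Avoiding-swap {Y = Y})

≟-true⇒≡ : ∀ {n} {a b : Fin n} → does (a ≟ b) ≡ true → a ≡ b
≟-true⇒≡ {a = a} {b} eq with a ≟ b | eq
... | yes a≡b | _ = a≡b

Fin+-elim : ∀ {m n} (P : Fin (m + n) → Set) → (∀ a → P (a ↑ˡ n)) → (∀ b → P (m ↑ʳ b)) → ∀ i → P i
Fin+-elim {m} P left right i with splitAt m i in eq
... | inj₁ a = subst P (splitAt⁻¹-↑ˡ eq) (left a)
... | inj₂ b = subst P (splitAt⁻¹-↑ʳ eq) (right b)

sumℚ-cong : ∀ {n} {f g : Fin n → ℚ} → (∀ l → f l ≡ g l) → sumℚ f ≡ sumℚ g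
sumℚ-cong {zero}  f≗g = refl
sumℚ-cong {suc n} f≗g = cong₂ _+ℚ_ (f≗g zero) (sumℚ-cong (f≗g ∘ suc))

sumℚ-zero : ∀ {n} {f : Fin n → ℚ} → (∀ l → f l ≡ 0ℚ) → sumℚ f ≡ 0ℚ
sumℚ-zero {zero}  f≗0 = refl
sumℚ-zero {suc n} f≗0 = trans (cong₂ _+ℚ_ (f≗0 zero) (sumℚ-zero (f≗0 ∘ suc))) (ℚ.+-identityˡ 0ℚ)

select : ∀ {m n m′ n′} → Mat ℚ m n → (Fin m′ → Maybe (Fin m)) → (Fin n′ → Maybe (Fin n)) → Mat ℚ m′ n′
select X ρ γ i j = maybe′ (λ a → maybe′ (X a) 0ℚ (γ j)) 0ℚ (ρ i)

RankLe-select : ∀ {m n m′ n′ w} {X : Mat ℚ m n} {Z : Mat ℚ m′ n′}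
                (ρ : Fin m′ → Maybe (Fin m)) (γ : Fin n′ → Maybe (Fin n)) →
                (∀ i j → Z i j ≡ select X ρ γ i j) → RankLe X w → RankLe Z w
RankLe-select {w = w} {X} ρ γ Z≡ (P , Q , X≡PQ) = P′ , Q′ , λ i j → trans (Z≡ i j) (factor i j)
  where
  P′ : Mat ℚ _ w
  P′ i l = maybe′ (λ a → P a l) 0ℚ (ρ i)
  Q′ : Mat ℚ w _
  Q′ l j = maybe′ (λ b → Q l b) 0ℚ (γ j)
  factor : ∀ i j → select X ρ γ i j ≡ sumℚ (λ l → P′ i l *ℚ Q′ l j)
  factor i j with ρ i | γ j
  ... | just a  | just b  = X≡PQ a b
  ... | just a  | nothing = sym (sumℚ-zero {w} (λ l → ℚ.*-zeroʳ (P a l)))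
  ... | nothing | just b  = sym (sumℚ-zero {w} (λ l → ℚ.*-zeroˡ (Q l b)))
  ... | nothing | nothing = sym (sumℚ-zero {w} (λ l → ℚ.*-zeroˡ 0ℚ))

RankLe-upper : ∀ {m m′ n n′ w} {X : Mat ℚ m n′} {Z : Mat ℚ (m + m′) n} (f : Fin n → Fin n′) →
               (∀ a j → Z (a ↑ˡ m′) j ≡ X a (f j)) → (∀ b j → Z (m ↑ʳ b) j ≡ 0ℚ) → RankLe X w → RankLe Z w
RankLe-upper {m} {m′} {X = X} {Z} f upper lower = RankLe-select rows (just ∘ f) (Fin+-elim _ upper′ lower′)
  where
  rows : Fin (m + m′) → Maybe (Fin m)
  rows = [ just , (λ _ → nothing) ]′ ∘ splitAt m
  upper′ : ∀ a j → Z (a ↑ˡ m′) j ≡ select X rows (just ∘ f) (a ↑ˡ m′) j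
  upper′ a j rewrite splitAt-↑ˡ m a m′ = upper a j
  lower′ : ∀ b j → Z (m ↑ʳ b) j ≡ select X rows (just ∘ f) (m ↑ʳ b) j
  lower′ b j rewrite splitAt-↑ʳ m m′ b = lower b j

RankLe-lower : ∀ {m m′ n n′ w} {X : Mat ℚ m′ n′} {Z : Mat ℚ (m + m′) n} (f : Fin n → Fin n′) →
               (∀ a j → Z (a ↑ˡ m′) j ≡ 0ℚ) → (∀ b j → Z (m ↑ʳ b) j ≡ X b (f j)) → RankLe X w → RankLe Z w
RankLe-lower {m} {m′} {X = X} {Z} f upper lower = RankLe-select rows (just ∘ f) (Fin+-elim _ upper′ lower′)
  where
  rows : Fin (m + m′) → Maybe (Fin m′)
  rows = [ (λ _ → nothing) , just ]′ ∘ splitAt m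
  upper′ : ∀ a j → Z (a ↑ˡ m′) j ≡ select X rows (just ∘ f) (a ↑ˡ m′) j
  upper′ a j rewrite splitAt-↑ˡ m a m′ = upper a j
  lower′ : ∀ b j → Z (m ↑ʳ b) j ≡ select X rows (just ∘ f) (m ↑ʳ b) j
  lower′ b j rewrite splitAt-↑ʳ m m′ b = lower b j

RankLe-transpose : ∀ {m n w} {X : Mat ℚ m n} {Z : Mat ℚ n m} →
                   (∀ i j → Z i j ≡ X j i) → RankLe X w → RankLe Z w
RankLe-transpose Z≡ (P , Q , X≡PQ) = (λ i l → Q l i) , (λ l j → P j l) ,
  λ i j → trans (Z≡ i j) (trans (X≡PQ j i) (sumℚ-cong (λ l → ℚ.*-comm (P j l) (Q l i))))

∣tabulate∣-cong : ∀ {n} {f g : Fin n → Bool} → (∀ i → f i ≡ g i) → ∣ tabulate f ∣ ≡ ∣ tabulate g ∣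
∣tabulate∣-cong f≗g = cong ∣_∣ (tabulate-cong f≗g)

∣tabulate∣-++ : ∀ m {n} (f : Fin (m + n) → Bool) →
                ∣ tabulate f ∣ ≡ ∣ tabulate (f ∘ (_↑ˡ n)) ∣ + ∣ tabulate (f ∘ (m ↑ʳ_)) ∣
∣tabulate∣-++ zero    f = refl
∣tabulate∣-++ (suc m) f with f zero
... | true  = cong suc (∣tabulate∣-++ m (f ∘ suc))
... | false = ∣tabulate∣-++ m (f ∘ suc)

∣tabulate-false∣ : ∀ n → ∣ tabulate {n = n} (λ _ → false) ∣ ≡ 0
∣tabulate-false∣ zero    = refl
∣tabulate-false∣ (suc n) = ∣tabulate-false∣ n

∣tabulate-≟∣ : ∀ {n} (a : Fin n) → ∣ tabulate (λ b → does (b ≟ a)) ∣ ≡ 1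
∣tabulate-≟∣ {suc n} zero    = cong suc (∣tabulate-false∣ n)
∣tabulate-≟∣ {suc n} (suc a) = ∣tabulate-≟∣ a

record RootedTree (k : ℕ) : Set where
  field
    tree : SimpleGraph
  open SimpleGraph tree public
  field
    connected            : Connected tree
    acyclic              : Acyclic tree
    subcubic             : ∀ v → degree tree v ≤ 3
    root                 : Fin size
    root-degree          : degree tree root ≡ 0 ⊎ degree tree root ≡ 2
    leafVertex           : Fin k → Fin size
    leafVertex-isLeaf    : ∀ i → degree tree (leafVertex i) ≤ 1
    leafIndex            : ∀ x → degree tree x ≤ 1 → Fin k
    leafIndex-leafVertex : ∀ i p → leafIndex (leafVertex i) p ≡ i
    leafVertex-leafIndex : ∀ x p → leafVertex (leafIndex x p) ≡ x

singletonTree : RootedTree 1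
singletonTree = record
  { tree                 = record { size = 1 ; adj = λ _ _ → false ; sym = λ _ _ → refl ; irrefl = λ _ → refl }
  ; connected            = λ { zero zero → here }
  ; acyclic              = λ _ _ ()
  ; subcubic             = λ { zero → z≤n }
  ; root                 = zero
  ; root-degree          = inj₁ refl
  ; leafVertex           = λ _ → zero
  ; leafVertex-isLeaf    = λ { zero → z≤n }
  ; leafIndex            = λ _ _ → zero
  ; leafIndex-leafVertex = λ { zero _ → refl }
  ; leafVertex-leafIndex = λ { zero _ → refl }
  }

root-subcubic : ∀ {d} → d ≡ 0 ⊎ d ≡ 2 → suc d ≤ 3
root-subcubic (inj₁ refl) = s≤s z≤n
root-subcubic (inj₂ refl) = s≤s (s≤s (s≤s z≤n))

root-isLeaf : ∀ {d} → d ≡ 0 ⊎ d ≡ 2 → d ≤ 1 → suc d ≤ 1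
root-isLeaf (inj₁ refl) _           = s≤s z≤n
root-isLeaf (inj₂ refl) (s≤s ())

data Side : Set where
  first second : Side

other : Side → Side
other first  = second
other second = first

module Join {k : Side → ℕ} (R : (s : Side) → RootedTree (k s)) where
  private
    module T (s : Side) = RootedTree (R s)

  sz : Side → ℕ
  sz s = T.size s

  data Node : Set where
    new   : Node
    inner : (s : Side) → Fin (sz s) → Node

  N : ℕ
  N = suc (sz first + sz second)

  encode : Node → Fin N
  encode new              = zero
  encode (inner first a)  = suc (a ↑ˡ sz second)
  encode (inner second b) = suc (sz first ↑ʳ b)

  decode : Fin N → Node
  decode zero    = new
  decode (suc x) = [ inner first , inner second ]′ (splitAt (sz first) x)

  decode-encode : ∀ c → decode (encode c) ≡ c
  decode-encode new              = refl
  decode-encode (inner first a)  = cong [ inner first , inner second ]′ (splitAt-↑ˡ (sz first) a (sz second))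
  decode-encode (inner second b) = cong [ inner first , inner second ]′ (splitAt-↑ʳ (sz first) (sz second) b)

  encode-decode : ∀ x → encode (decode x) ≡ x
  encode-decode zero    = refl
  encode-decode (suc x) = trans (encode-inner (splitAt (sz first) x)) (cong suc (join-splitAt (sz first) (sz second) x))
    where
    encode-inner : ∀ y → encode ([ inner first , inner second ]′ y) ≡ suc (join (sz first) (sz second) y)
    encode-inner (inj₁ a) = refl
    encode-inner (inj₂ b) = refl

  Node-elim : (P : Fin N → Set) → (∀ c → P (encode c)) → ∀ x → P x
  Node-elim P h x = subst P (encode-decode x) (h (decode x))

  encode-injective : ∀ {c d} → encode c ≡ encode d → c ≡ d
  encode-injective {c} {d} eq = trans (sym (decode-encode c)) (trans (cong decode eq) (decode-encode d))

  adjInner : ∀ s t → Fin (sz s) → Fin (sz t) → Bool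
  adjInner first  first  = T.adj first
  adjInner second second = T.adj second
  adjInner first  second _ _ = false
  adjInner second first  _ _ = false

  adjN : Node → Node → Bool
  adjN new         new         = false
  adjN new         (inner t b) = does (b ≟ T.root t)
  adjN (inner s a) new         = does (a ≟ T.root s)
  adjN (inner s a) (inner t b) = adjInner s t a b

  adjInner-same : ∀ s a b → adjInner s s a b ≡ T.adj s a b
  adjInner-same first  a b = refl
  adjInner-same second a b = refl

  adjN-sym : ∀ c d → adjN c d ≡ adjN d c
  adjN-sym new                new                = refl
  adjN-sym new                (inner t b)        = refl
  adjN-sym (inner s a)        new                = refl
  adjN-sym (inner first a)    (inner first b)    = T.sym first a b
  adjN-sym (inner second a)   (inner second b)   = T.sym second a b
  adjN-sym (inner first a)    (inner second b)   = refl
  adjN-sym (inner second a)   (inner first b)    = refl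

  adjN-irrefl : ∀ c → adjN c c ≡ false
  adjN-irrefl new         = refl
  adjN-irrefl (inner s a) = trans (adjInner-same s a a) (T.irrefl s a)

  joined : SimpleGraph
  joined = record
    { size   = N
    ; adj    = λ x y → adjN (decode x) (decode y)
    ; sym    = λ x y → adjN-sym (decode x) (decode y)
    ; irrefl = λ x → adjN-irrefl (decode x)
    }

  adj-encode : ∀ c d → SimpleGraph.adj joined (encode c) (encode d) ≡ adjN c d
  adj-encode c d = cong₂ adjN (decode-encode c) (decode-encode d)

  edge-encode : ∀ {c d} → adjN c d ≡ true → Edge joined (encode c) (encode d)
  edge-encode {c} {d} e = trans (adj-encode c d) e

  edge-decode : ∀ {c d} → Edge joined (encode c) (encode d) → adjN c d ≡ true
  edge-decode {c} {d} e = trans (sym (adj-encode c d)) e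

  edge-inner : ∀ s {a b} → Edge (T.tree s) a b → Edge joined (encode (inner s a)) (encode (inner s b))
  edge-inner s {a} {b} e = edge-encode {inner s a} {inner s b} (trans (adjInner-same s a b) e)

  edge-root : ∀ s → Edge joined (encode (inner s (T.root s))) (encode new)
  edge-root s = edge-encode {inner s (T.root s)} {new} (dec-true (T.root s ≟ T.root s) refl)

  step-decode : ∀ {ok : Fin N → Fin N → Set} (P : Node → Node → Set) →
                (∀ c d → ok (encode c) (encode d) → P c d) → ∀ {x y} → ok x y → P (decode x) (decode y)
  step-decode {ok} P h {x} {y} s =
    h (decode x) (decode y) (subst₂ ok (sym (encode-decode x)) (sym (encode-decode y)) s)

  ∣tabulate-decode∣ : ∀ (p : Node → Bool) → ∣ tabulate (p ∘ decode) ∣ ≡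
                      ∣ p new ∷ [] ∣ + (∣ tabulate (p ∘ inner first) ∣ + ∣ tabulate (p ∘ inner second) ∣)
  ∣tabulate-decode∣ p = trans (∣tabulate∣-++ 1 (p ∘ decode)) (cong (∣ p new ∷ [] ∣ +_)
    (trans (∣tabulate∣-++ (sz first) (p ∘ decode ∘ suc))
           (cong₂ _+_ (∣tabulate∣-cong (cong p ∘ decode-encode ∘ inner first))
                      (∣tabulate∣-cong (cong p ∘ decode-encode ∘ inner second)))))

  degree-encode : ∀ c → degree joined (encode c) ≡
                  ∣ adjN c new ∷ [] ∣ + (∣ tabulate (adjN c ∘ inner first) ∣ + ∣ tabulate (adjN c ∘ inner second) ∣)
  degree-encode c = trans (∣tabulate∣-cong (λ y → cong (λ c′ → adjN c′ (decode y)) (decode-encode c)))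
                          (∣tabulate-decode∣ (adjN c))

  degree-new : degree joined (encode new) ≡ 2
  degree-new = trans (degree-encode new) (cong₂ _+_ (∣tabulate-≟∣ (T.root first)) (∣tabulate-≟∣ (T.root second)))

  degree-inner : ∀ s a → degree joined (encode (inner s a)) ≡ ∣ does (a ≟ T.root s) ∷ [] ∣ + degree (T.tree s) a
  degree-inner first a = trans (degree-encode (inner first a))
    (cong (∣ does (a ≟ T.root first) ∷ [] ∣ +_)
          (trans (cong (degree (T.tree first) a +_) (∣tabulate-false∣ (sz second))) (+-identityʳ _)))
  degree-inner second a = trans (degree-encode (inner second a))
    (cong (λ m → ∣ does (a ≟ T.root second) ∷ [] ∣ + (m + degree (T.tree second) a)) (∣tabulate-false∣ (sz first)))

  degree-root : ∀ s → degree joined (encode (inner s (T.root s))) ≡ suc (degree (T.tree s) (T.root s))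
  degree-root s = trans (degree-inner s (T.root s))
    (cong (λ b → ∣ b ∷ [] ∣ + degree (T.tree s) (T.root s)) (dec-true (T.root s ≟ T.root s) refl))

  degree-nonroot : ∀ s {a} → a ≢ T.root s → degree joined (encode (inner s a)) ≡ degree (T.tree s) a
  degree-nonroot s {a} a≢ρ = trans (degree-inner s a)
    (cong (λ b → ∣ b ∷ [] ∣ + degree (T.tree s) a) (dec-false (a ≟ T.root s) a≢ρ))

  subcubic : ∀ x → degree joined x ≤ 3
  subcubic = Node-elim _ subcubic-encode
    where
    subcubic-encode : ∀ c → degree joined (encode c) ≤ 3
    subcubic-encode new = subst (_≤ 3) (sym degree-new) (s≤s (s≤s z≤n))
    subcubic-encode (inner s a) with a ≟ T.root s
    ... | yes refl = subst (_≤ 3) (sym (degree-root s)) (root-subcubic (T.root-degree s))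
    ... | no a≢ρ   = subst (_≤ 3) (sym (degree-nonroot s a≢ρ)) (T.subcubic s a)

  isLeaf-inner⁺ : ∀ s a → degree (T.tree s) a ≤ 1 → degree joined (encode (inner s a)) ≤ 1
  isLeaf-inner⁺ s a p with a ≟ T.root s
  ... | yes refl = subst (_≤ 1) (sym (degree-root s)) (root-isLeaf (T.root-degree s) p)
  ... | no a≢ρ   = subst (_≤ 1) (sym (degree-nonroot s a≢ρ)) p

  isLeaf-inner⁻ : ∀ s a → degree joined (encode (inner s a)) ≤ 1 → degree (T.tree s) a ≤ 1
  isLeaf-inner⁻ s a p = ≤-trans (m≤n+m _ _) (subst (_≤ 1) (degree-inner s a) p)

  new-isNotLeaf : ¬ degree joined (encode new) ≤ 1
  new-isNotLeaf p with subst (_≤ 1) degree-new p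
  ... | s≤s ()

  toNew : ∀ c → Walk joined (Edge joined) (encode c) (encode new)
  toNew new         = here
  toNew (inner s a) = mapWalk (encode ∘ inner s) (edge-inner s) (T.connected s a (T.root s)) ++ʷ step (edge-root s) here

  connected : Connected joined
  connected = Node-elim _ λ c → Node-elim _ λ d → toNew c ++ʷ reverseEdgeWalk (toNew d)

  toSide : (s : Side) → Node → Fin (sz s)
  toSide s      new              = T.root s
  toSide first  (inner first a)  = a
  toSide second (inner second b) = b
  toSide first  (inner second _) = T.root first
  toSide second (inner first _)  = T.root second

  toSide-inner : ∀ s a → toSide s (decode (encode (inner s a))) ≡ a
  toSide-inner first  a = cong (toSide first) (decode-encode (inner first a))
  toSide-inner second a = cong (toSide second) (decode-encode (inner second a))

  toSide-root : ∀ s t {b} → b ≡ T.root t → toSide s (inner t b) ≡ T.root s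
  toSide-root first  first  b≡ρ = b≡ρ
  toSide-root first  second _   = refl
  toSide-root second first  _   = refl
  toSide-root second second b≡ρ = b≡ρ

  SameEdge-inner : ∀ s {a b u v} → SameEdge (T.tree s) a b u v →
                   SameEdge joined (encode (inner s a)) (encode (inner s b)) (encode (inner s u)) (encode (inner s v))
  SameEdge-inner s = SameEdge-map {T.tree s} {joined} (encode ∘ inner s)

  project-step : ∀ s {u v} c d → Avoiding joined (encode (inner s u)) (encode (inner s v)) (encode c) (encode d) →
                 toSide s c ≡ toSide s d ⊎ Avoiding (T.tree s) u v (toSide s c) (toSide s d)
  project-step s c d (e , ¬same) = go s c d (edge-decode {c} {d} e) ¬same
    where
    go : ∀ s {u v} c d → adjN c d ≡ true →
         ¬ SameEdge joined (encode c) (encode d) (encode (inner s u)) (encode (inner s v)) →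
         toSide s c ≡ toSide s d ⊎ Avoiding (T.tree s) u v (toSide s c) (toSide s d)
    go s new         new         ()
    go s new         (inner t b) e _ = inj₁ (sym (toSide-root s t (≟-true⇒≡ e)))
    go s (inner t a) new         e _ = inj₁ (toSide-root s t (≟-true⇒≡ e))
    go first  (inner first a)  (inner first b)  e ¬same = inj₂ (e , ¬same ∘ SameEdge-inner first)
    go second (inner second a) (inner second b) e ¬same = inj₂ (e , ¬same ∘ SameEdge-inner second)
    go first  (inner second a) (inner second b) e _ = inj₁ refl
    go second (inner first a)  (inner first b)  e _ = inj₁ refl
    go s (inner first a)  (inner second b) ()
    go s (inner second a) (inner first b)  ()

  project : ∀ s {u v a b} →
            Walk joined (Avoiding joined (encode (inner s u)) (encode (inner s v))) (encode (inner s a)) (encode (inner s b)) →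
            Walk (T.tree s) (Avoiding (T.tree s) u v) a b
  project s {u} {v} {a} {b} w = subst₂ (Walk (T.tree s) (Avoiding (T.tree s) u v)) (toSide-inner s a) (toSide-inner s b)
    (collapseWalk (toSide s ∘ decode) (step-decode {Avoiding joined (encode (inner s u)) (encode (inner s v))} P (project-step s)) w)
    where
    P : Node → Node → Set
    P c d = toSide s c ≡ toSide s d ⊎ Avoiding (T.tree s) u v (toSide s c) (toSide s d)

  inSide : Side → Node → Bool
  inSide _      new              = false
  inSide first  (inner first _)  = true
  inSide second (inner second _) = true
  inSide first  (inner second _) = false
  inSide second (inner first _)  = false

  RootEdge : Side → Fin N → Fin N → Set
  RootEdge s = Avoiding joined (encode (inner s (T.root s))) (encode new)

  inSide-step : ∀ s c d → RootEdge s (encode c) (encode d) → inSide s c ≡ inSide s d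
  inSide-step s c d (e , ¬same) = go s c d (edge-decode {c} {d} e) ¬same
    where
    crossing : ∀ s {b} → b ≡ T.root s →
               SameEdge joined (encode new) (encode (inner s b)) (encode (inner s (T.root s))) (encode new)
    crossing s b≡ρ = inj₂ (refl , cong (encode ∘ inner s) b≡ρ)
    go : ∀ s c d → adjN c d ≡ true →
         ¬ SameEdge joined (encode c) (encode d) (encode (inner s (T.root s))) (encode new) → inSide s c ≡ inSide s d
    go s new new ()
    go first  new (inner first b)  e ¬same = ⊥-elim (¬same (crossing first (≟-true⇒≡ e)))
    go second new (inner second b) e ¬same = ⊥-elim (¬same (crossing second (≟-true⇒≡ e)))
    go first  new (inner second b) _ _ = refl
    go second new (inner first b)  _ _ = refl
    go first  (inner first a)  new e ¬same = ⊥-elim (¬same (SameEdge-reverse {joined} (crossing first (≟-true⇒≡ e))))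
    go second (inner second a) new e ¬same = ⊥-elim (¬same (SameEdge-reverse {joined} (crossing second (≟-true⇒≡ e))))
    go first  (inner second a) new _ _ = refl
    go second (inner first a)  new _ _ = refl
    go first  (inner first a)  (inner first b)  _ _ = refl
    go first  (inner second a) (inner second b) _ _ = refl
    go second (inner first a)  (inner first b)  _ _ = refl
    go second (inner second a) (inner second b) _ _ = refl
    go s (inner first a)  (inner second b) ()
    go s (inner second a) (inner first b)  ()

  inSide-invariant : ∀ s {x y} → Walk joined (RootEdge s) x y → inSide s (decode x) ≡ inSide s (decode y)
  inSide-invariant s =
    walk-invariant (inSide s ∘ decode) (step-decode {RootEdge s} (λ c d → inSide s c ≡ inSide s d) (inSide-step s))

  inSide-same : ∀ s a → inSide s (inner s a) ≡ true
  inSide-same first  a = refl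
  inSide-same second a = refl

  inSide-other : ∀ s a → inSide s (inner (other s) a) ≡ false
  inSide-other first  a = refl
  inSide-other second a = refl

  RootEdge-separates : ∀ s {c} a → inSide s c ≡ false → ¬ Walk joined (RootEdge s) (encode c) (encode (inner s a))
  RootEdge-separates s {c} a outside w = not-¬ outside (trans same-side (inSide-same s a))
    where
    same-side : inSide s c ≡ inSide s (inner s a)
    same-side = subst₂ (λ c′ d′ → inSide s c′ ≡ inSide s d′) (decode-encode c) (decode-encode (inner s a))
                       (inSide-invariant s w)

  acyclic : Acyclic joined
  acyclic = Node-elim _ λ c → Node-elim _ λ d e → acyclic-encode c d (edge-decode {c} {d} e)
    where
    acyclic-encode : ∀ c d → adjN c d ≡ true → ¬ Walk joined (Avoiding joined (encode c) (encode d)) (encode c) (encode d)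
    acyclic-encode new new ()
    acyclic-encode new (inner t b) e w with ≟-true⇒≡ {a = b} {T.root t} e
    ... | refl = RootEdge-separates t (T.root t) refl (swapAvoided w)
    acyclic-encode (inner s a) new e w with ≟-true⇒≡ {a = a} {T.root s} e
    ... | refl = RootEdge-separates s (T.root s) refl (reverseWalk (Avoiding-reverse {joined}) w)
    acyclic-encode (inner first a)  (inner first b)  e w = T.acyclic first a b e (project first w)
    acyclic-encode (inner second a) (inner second b) e w = T.acyclic second a b e (project second w)
    acyclic-encode (inner first a)  (inner second b) ()
    acyclic-encode (inner second a) (inner first b)  ()

  encode-inner-injective : ∀ s {a b} → encode (inner s a) ≡ encode (inner s b) → a ≡ b
  encode-inner-injective s eq with encode-injective eq
  ... | refl = refl

  encode-new≢inner : ∀ {s a} → encode new ≢ encode (inner s a)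
  encode-new≢inner eq with encode-injective eq
  ... | ()

  encode-inner≢new : ∀ {s a} → encode (inner s a) ≢ encode new
  encode-inner≢new = encode-new≢inner ∘ sym

  encode-other≢inner : ∀ s {a b} → encode (inner (other s) a) ≢ encode (inner s b)
  encode-other≢inner first  {a} {b} eq with encode-injective {inner second a} {inner first b} eq
  ... | ()
  encode-other≢inner second {a} {b} eq with encode-injective {inner first a} {inner second b} eq
  ... | ()

  lift : ∀ s {a b x y} → Walk (T.tree s) (Avoiding (T.tree s) a b) x y →
         Walk joined (Avoiding joined (encode (inner s a)) (encode (inner s b))) (encode (inner s x)) (encode (inner s y))
  lift s = mapWalk (encode ∘ inner s)
    (λ (e , ¬same) → edge-inner s e , ¬same ∘ SameEdge-unmap {T.tree s} {joined} (encode ∘ inner s) (encode-inner-injective s))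

  inner-walk : ∀ s {U V} → (∀ z → encode (inner s z) ≢ V) →
               ∀ x y → Walk joined (Avoiding joined U V) (encode (inner s x)) (encode (inner s y))
  inner-walk s ≢V x y = mapWalk (encode ∘ inner s)
    (λ e → edge-inner s e , [ ≢V _ ∘ proj₂ , ≢V _ ∘ proj₁ ]′) (T.connected s x y)

  enter : ∀ s {U V} → encode new ≢ U → encode new ≢ V → Avoiding joined U V (encode new) (encode (inner s (T.root s)))
  enter s ≢U ≢V =
    Edge-sym {joined} {encode (inner s (T.root s))} {encode new} (edge-root s) , [ ≢U ∘ proj₁ , ≢V ∘ proj₁ ]′

  K : ℕ
  K = k first + k second

  inject : ∀ s → Fin (k s) → Fin K
  inject first  i = i ↑ˡ k second
  inject second j = k first ↑ʳ j

  inject-elim : (P : Fin K → Set) → (∀ s i → P (inject s i)) → ∀ i → P i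
  inject-elim P h = Fin+-elim P (h first) (h second)

  leafVertex : Fin K → Fin N
  leafVertex i = [ encode ∘ inner first ∘ T.leafVertex first , encode ∘ inner second ∘ T.leafVertex second ]′
                   (splitAt (k first) i)

  leafVertex-inject : ∀ s i → leafVertex (inject s i) ≡ encode (inner s (T.leafVertex s i))
  leafVertex-inject first  i = cong [ _ , _ ]′ (splitAt-↑ˡ (k first) i (k second))
  leafVertex-inject second j = cong [ _ , _ ]′ (splitAt-↑ʳ (k first) (k second) j)

  leafVertex-isLeaf : ∀ i → degree joined (leafVertex i) ≤ 1
  leafVertex-isLeaf = inject-elim _ λ s i →
    subst (λ x → degree joined x ≤ 1) (sym (leafVertex-inject s i)) (isLeaf-inner⁺ s _ (T.leafVertex-isLeaf s i))

  leafIndexNode : ∀ c → degree joined (encode c) ≤ 1 → Fin K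
  leafIndexNode new         p = ⊥-elim (new-isNotLeaf p)
  leafIndexNode (inner s a) p = inject s (T.leafIndex s a (isLeaf-inner⁻ s a p))

  leafIndexNode-cong : ∀ {c d} → c ≡ d → ∀ p q → leafIndexNode c p ≡ leafIndexNode d q
  leafIndexNode-cong {c} refl p q = cong (leafIndexNode c) (≤-irrelevant p q)

  leafIndex : ∀ x → degree joined x ≤ 1 → Fin K
  leafIndex x p = leafIndexNode (decode x) (subst (λ y → degree joined y ≤ 1) (sym (encode-decode x)) p)

  leafIndex-leafVertex : ∀ i p → leafIndex (leafVertex i) p ≡ i
  leafIndex-leafVertex = inject-elim _ λ s i p →
    trans (leafIndexNode-cong (trans (cong decode (leafVertex-inject s i)) (decode-encode (inner s (T.leafVertex s i)))) _
                              (isLeaf-inner⁺ s _ (T.leafVertex-isLeaf s i)))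
          (cong (inject s) (T.leafIndex-leafVertex s i _))

  leafVertex-leafIndexNode : ∀ c p → leafVertex (leafIndexNode c p) ≡ encode c
  leafVertex-leafIndexNode new         p = ⊥-elim (new-isNotLeaf p)
  leafVertex-leafIndexNode (inner s a) p =
    trans (leafVertex-inject s _) (cong (encode ∘ inner s) (T.leafVertex-leafIndex s a _))

  leafVertex-leafIndex : ∀ x p → leafVertex (leafIndex x p) ≡ x
  leafVertex-leafIndex x p = trans (leafVertex-leafIndexNode (decode x) _) (encode-decode x)

  joinedTree : RootedTree K
  joinedTree = record
    { tree                 = joined
    ; connected            = connected
    ; acyclic              = acyclic
    ; subcubic             = subcubic
    ; root                 = encode new
    ; root-degree          = inj₂ degree-new
    ; leafVertex           = leafVertex
    ; leafVertex-isLeaf    = leafVertex-isLeaf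
    ; leafIndex            = leafIndex
    ; leafIndex-leafVertex = leafIndex-leafVertex
    ; leafVertex-leafIndex = leafVertex-leafIndex
    }

masked : Bool → ℕ → ℚ
masked b m = if b then ℤ.+ m / 1 else 0ℚ

-- The dangling edges of the subgraph induced on χ: its edges to the rest of G, then the ports of B.
-- Rows of vertices outside χ and columns of vertices inside χ are zero rather than deleted.
boundaryMatrix : ∀ {k n} → Mat ℕ k k → Mat ℕ k n → (Fin k → Bool) → Mat ℚ k (k + n)
boundaryMatrix {k} G B χ i = [ cutMatrix G χ i , masked (χ i) ∘ B i ]′ ∘ splitAt k

boundaryMatrix-outside : ∀ {k n} (G : Mat ℕ k k) (B : Mat ℕ k n) χ {i} → χ i ≡ false →
                         ∀ j → boundaryMatrix G B χ i j ≡ 0ℚ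
boundaryMatrix-outside {k} G B χ {i} χi≡false j rewrite χi≡false with splitAt k j
... | inj₁ _ = refl
... | inj₂ _ = refl

boundaryMatrix-vertex : ∀ {k n} (G : Mat ℕ k k) (B : Mat ℕ k n) χ i j → boundaryMatrix G B χ i (j ↑ˡ n) ≡ cutMatrix G χ i j
boundaryMatrix-vertex {k} {n} G B χ i j rewrite splitAt-↑ˡ k j n = refl

boundaryMatrix-port : ∀ {k n} (G : Mat ℕ k k) (B : Mat ℕ k n) χ i p → boundaryMatrix G B χ i (k ↑ʳ p) ≡ masked (χ i) (B i p)
boundaryMatrix-port {k} {n} G B χ i p rewrite splitAt-↑ʳ k n p = refl

cutMatrix-outside : ∀ {k} (G : Mat ℕ k k) χ i {j} → χ j ≡ false → cutMatrix G χ i j ≡ masked (χ i) (G i j + G j i)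
cutMatrix-outside G χ i χj≡false rewrite χj≡false | ∧-identityʳ (χ i) = refl

RankLe-cut : ∀ {k n w} (G : Mat ℕ k k) (B : Mat ℕ k n) χ → RankLe (boundaryMatrix G B χ) w → RankLe (cutMatrix G χ) w
RankLe-cut {n = n} G B χ = RankLe-select just (just ∘ (_↑ˡ n)) (λ i j → sym (boundaryMatrix-vertex G B χ i j))

RankLe-boundary-all : ∀ {k n w} (G : Mat ℕ k k) (B : Mat ℕ k n) χ → (∀ i → χ i ≡ true) →
                      RankLe (toℚ B) w → RankLe (boundaryMatrix G B χ) w
RankLe-boundary-all {k} G B χ all = RankLe-select just ([ (λ _ → nothing) , just ]′ ∘ splitAt k) entry
  where
  entry : ∀ i j → boundaryMatrix G B χ i j ≡ select (toℚ B) just ([ (λ _ → nothing) , just ]′ ∘ splitAt k) i j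
  entry i j with splitAt k j
  ... | inj₁ j′ rewrite all i | all j′ = refl
  ... | inj₂ p  rewrite all i = refl

cutMatrix-complement : ∀ {k} (G : Mat ℕ k k) χ i j → cutMatrix G χ i j ≡ cutMatrix G (not ∘ χ) j i
cutMatrix-complement G χ i j with χ i | χ j
... | true  | true  = refl
... | true  | false = cong (λ m → ℤ.+ m / 1) (+-comm (G i j) (G j i))
... | false | true  = refl
... | false | false = refl

cutMatrix-cong : ∀ {k k′} {G : Mat ℕ k k} {H : Mat ℕ k′ k′} {χ ψ i j i′ j′} →
                 χ i ≡ ψ i′ → χ j ≡ ψ j′ → G i j + G j i ≡ H i′ j′ + H j′ i′ →
                 cutMatrix G χ i j ≡ cutMatrix H ψ i′ j′
cutMatrix-cong χi χj edges rewrite χi | χj | edges = refl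

module _ {k₁ k₂ : ℕ} {G₁ : Mat ℕ k₁ k₁} {C : Mat ℕ k₁ k₂} {G₂ : Mat ℕ k₂ k₂} where

  upperBlock-↑ˡ-↑ˡ : ∀ a b → upperBlock G₁ C G₂ (a ↑ˡ k₂) (b ↑ˡ k₂) ≡ G₁ a b
  upperBlock-↑ˡ-↑ˡ a b rewrite splitAt-↑ˡ k₁ a k₂ | splitAt-↑ˡ k₁ b k₂ = refl

  upperBlock-↑ˡ-↑ʳ : ∀ a b → upperBlock G₁ C G₂ (a ↑ˡ k₂) (k₁ ↑ʳ b) ≡ C a b
  upperBlock-↑ˡ-↑ʳ a b rewrite splitAt-↑ˡ k₁ a k₂ | splitAt-↑ʳ k₁ k₂ b = refl

  upperBlock-↑ʳ-↑ˡ : ∀ a b → upperBlock G₁ C G₂ (k₁ ↑ʳ a) (b ↑ˡ k₂) ≡ 0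
  upperBlock-↑ʳ-↑ˡ a b rewrite splitAt-↑ʳ k₁ k₂ a | splitAt-↑ˡ k₁ b k₂ = refl

  upperBlock-↑ʳ-↑ʳ : ∀ a b → upperBlock G₁ C G₂ (k₁ ↑ʳ a) (k₁ ↑ʳ b) ≡ G₂ a b
  upperBlock-↑ʳ-↑ʳ a b rewrite splitAt-↑ʳ k₁ k₂ a | splitAt-↑ʳ k₁ k₂ b = refl

stack-↑ˡ : ∀ {k₁ k₂ n} (A₁ : Mat ℕ k₁ n) (A₂ : Mat ℕ k₂ n) a p → stack A₁ A₂ (a ↑ˡ k₂) p ≡ A₁ a p
stack-↑ˡ {k₁} {k₂} A₁ A₂ a p rewrite splitAt-↑ˡ k₁ a k₂ = refl

stack-↑ʳ : ∀ {k₁ k₂ n} (A₁ : Mat ℕ k₁ n) (A₂ : Mat ℕ k₂ n) a p → stack A₁ A₂ (k₁ ↑ʳ a) p ≡ A₂ a p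
stack-↑ʳ {k₁} {k₂} A₁ A₂ a p rewrite splitAt-↑ʳ k₁ k₂ a = refl

beside-↑ˡ : ∀ {k n m} (A : Mat ℕ k n) (C : Mat ℕ k m) a p → beside A C a (p ↑ˡ m) ≡ A a p
beside-↑ˡ {n = n} {m} A C a p rewrite splitAt-↑ˡ n p m = refl

beside-↑ʳ : ∀ {k n m} (A : Mat ℕ k n) (C : Mat ℕ k m) a b → beside A C a (n ↑ʳ b) ≡ C a b
beside-↑ʳ {n = n} {m} A C a b rewrite splitAt-↑ʳ n m b = refl

module Blocks {k₁ k₂ n} {G₁ : Mat ℕ k₁ k₁} {G₂ : Mat ℕ k₂ k₂} {C : Mat ℕ k₁ k₂}
              {A₁ : Mat ℕ k₁ n} {A₂ : Mat ℕ k₂ n}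
              {G : Mat ℕ (k₁ + k₂) (k₁ + k₂)} {B : Mat ℕ (k₁ + k₂) n}
              (sameGraph : SameGraph G (upperBlock G₁ C G₂)) (stacked : ∀ i j → B i j ≡ stack A₁ A₂ i j) where

  edges-first : ∀ a b → G (a ↑ˡ k₂) (b ↑ˡ k₂) + G (b ↑ˡ k₂) (a ↑ˡ k₂) ≡ G₁ a b + G₁ b a
  edges-first a b = trans (sameGraph _ _) (cong₂ _+_ (upperBlock-↑ˡ-↑ˡ a b) (upperBlock-↑ˡ-↑ˡ b a))

  edges-second : ∀ a b → G (k₁ ↑ʳ a) (k₁ ↑ʳ b) + G (k₁ ↑ʳ b) (k₁ ↑ʳ a) ≡ G₂ a b + G₂ b a
  edges-second a b = trans (sameGraph _ _)
    (cong₂ _+_ (upperBlock-↑ʳ-↑ʳ {G₁ = G₁} {C = C} a b) (upperBlock-↑ʳ-↑ʳ {G₁ = G₁} {C = C} b a))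

  edges-between : ∀ a b → G (a ↑ˡ k₂) (k₁ ↑ʳ b) + G (k₁ ↑ʳ b) (a ↑ˡ k₂) ≡ C a b
  edges-between a b = trans (sameGraph _ _)
    (trans (cong₂ _+_ (upperBlock-↑ˡ-↑ʳ a b) (upperBlock-↑ʳ-↑ˡ {G₁ = G₁} {C = C} {G₂ = G₂} b a)) (+-identityʳ _))

  ports-first : ∀ a p → B (a ↑ˡ k₂) p ≡ A₁ a p
  ports-first a p = trans (stacked _ _) (stack-↑ˡ A₁ A₂ a p)

  ports-second : ∀ a p → B (k₁ ↑ʳ a) p ≡ A₂ a p
  ports-second a p = trans (stacked _ _) (stack-↑ʳ A₁ A₂ a p)

  boundary-first : ∀ {w} χ → (∀ b → χ (k₁ ↑ʳ b) ≡ false) →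
                   RankLe (boundaryMatrix G₁ (beside A₁ C) (χ ∘ (_↑ˡ k₂))) w → RankLe (boundaryMatrix G B χ) w
  boundary-first χ second≡false =
    RankLe-upper column (λ a → Fin+-elim _ (Fin+-elim _ (vertex a) (crossing a)) (port a))
                        (λ b → boundaryMatrix-outside G B χ (second≡false b))
    where
    χ₁ : Fin k₁ → Bool
    χ₁ = χ ∘ (_↑ˡ k₂)
    X₁ : Mat ℚ k₁ (k₁ + (n + k₂))
    X₁ = boundaryMatrix G₁ (beside A₁ C) χ₁
    column : Fin ((k₁ + k₂) + n) → Fin (k₁ + (n + k₂))
    column = [ [ _↑ˡ (n + k₂) , (λ b → k₁ ↑ʳ (n ↑ʳ b)) ]′ ∘ splitAt k₁ , (λ p → k₁ ↑ʳ (p ↑ˡ k₂)) ]′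
             ∘ splitAt (k₁ + k₂)
    column-vertex : ∀ b → column ((b ↑ˡ k₂) ↑ˡ n) ≡ b ↑ˡ (n + k₂)
    column-vertex b rewrite splitAt-↑ˡ (k₁ + k₂) (b ↑ˡ k₂) n | splitAt-↑ˡ k₁ b k₂ = refl
    column-crossing : ∀ b → column ((k₁ ↑ʳ b) ↑ˡ n) ≡ k₁ ↑ʳ (n ↑ʳ b)
    column-crossing b rewrite splitAt-↑ˡ (k₁ + k₂) (k₁ ↑ʳ b) n | splitAt-↑ʳ k₁ k₂ b = refl
    column-port : ∀ p → column ((k₁ + k₂) ↑ʳ p) ≡ k₁ ↑ʳ (p ↑ˡ k₂)
    column-port p rewrite splitAt-↑ʳ (k₁ + k₂) n p = refl
    vertex : ∀ a b → boundaryMatrix G B χ (a ↑ˡ k₂) ((b ↑ˡ k₂) ↑ˡ n) ≡ X₁ a (column ((b ↑ˡ k₂) ↑ˡ n))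
    vertex a b = begin
      boundaryMatrix G B χ (a ↑ˡ k₂) ((b ↑ˡ k₂) ↑ˡ n)
        ≡⟨ boundaryMatrix-vertex G B χ _ _ ⟩
      cutMatrix G χ (a ↑ˡ k₂) (b ↑ˡ k₂)
        ≡⟨ cutMatrix-cong {G = G} {G₁} {χ} {χ₁} refl refl (edges-first a b) ⟩
      cutMatrix G₁ χ₁ a b
        ≡⟨ boundaryMatrix-vertex G₁ (beside A₁ C) χ₁ a b ⟨
      X₁ a (b ↑ˡ (n + k₂))
        ≡⟨ cong (X₁ a) (column-vertex b) ⟨
      X₁ a (column ((b ↑ˡ k₂) ↑ˡ n)) ∎
    crossing : ∀ a b → boundaryMatrix G B χ (a ↑ˡ k₂) ((k₁ ↑ʳ b) ↑ˡ n) ≡ X₁ a (column ((k₁ ↑ʳ b) ↑ˡ n))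
    crossing a b = begin
      boundaryMatrix G B χ (a ↑ˡ k₂) ((k₁ ↑ʳ b) ↑ˡ n)
        ≡⟨ boundaryMatrix-vertex G B χ _ _ ⟩
      cutMatrix G χ (a ↑ˡ k₂) (k₁ ↑ʳ b)
        ≡⟨ cutMatrix-outside G χ _ (second≡false b) ⟩
      masked (χ₁ a) (G (a ↑ˡ k₂) (k₁ ↑ʳ b) + G (k₁ ↑ʳ b) (a ↑ˡ k₂))
        ≡⟨ cong (masked (χ₁ a)) (trans (edges-between a b) (sym (beside-↑ʳ A₁ C a b))) ⟩
      masked (χ₁ a) (beside A₁ C a (n ↑ʳ b))
        ≡⟨ boundaryMatrix-port G₁ (beside A₁ C) χ₁ a (n ↑ʳ b) ⟨
      X₁ a (k₁ ↑ʳ (n ↑ʳ b))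
        ≡⟨ cong (X₁ a) (column-crossing b) ⟨
      X₁ a (column ((k₁ ↑ʳ b) ↑ˡ n)) ∎
    port : ∀ a p → boundaryMatrix G B χ (a ↑ˡ k₂) ((k₁ + k₂) ↑ʳ p) ≡ X₁ a (column ((k₁ + k₂) ↑ʳ p))
    port a p = begin
      boundaryMatrix G B χ (a ↑ˡ k₂) ((k₁ + k₂) ↑ʳ p)
        ≡⟨ boundaryMatrix-port G B χ _ p ⟩
      masked (χ₁ a) (B (a ↑ˡ k₂) p)
        ≡⟨ cong (masked (χ₁ a)) (trans (ports-first a p) (sym (beside-↑ˡ A₁ C a p))) ⟩
      masked (χ₁ a) (beside A₁ C a (p ↑ˡ k₂))
        ≡⟨ boundaryMatrix-port G₁ (beside A₁ C) χ₁ a (p ↑ˡ k₂) ⟨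
      X₁ a (k₁ ↑ʳ (p ↑ˡ k₂))
        ≡⟨ cong (X₁ a) (column-port p) ⟨
      X₁ a (column ((k₁ + k₂) ↑ʳ p)) ∎

  boundary-second : ∀ {w} χ → (∀ a → χ (a ↑ˡ k₂) ≡ false) →
                    RankLe (boundaryMatrix G₂ (beside A₂ (C ᵀ)) (χ ∘ (k₁ ↑ʳ_))) w → RankLe (boundaryMatrix G B χ) w
  boundary-second χ first≡false =
    RankLe-lower column (λ a → boundaryMatrix-outside G B χ (first≡false a))
                        (λ a → Fin+-elim _ (Fin+-elim _ (crossing a) (vertex a)) (port a))
    where
    χ₂ : Fin k₂ → Bool
    χ₂ = χ ∘ (k₁ ↑ʳ_)
    X₂ : Mat ℚ k₂ (k₂ + (n + k₁))
    X₂ = boundaryMatrix G₂ (beside A₂ (C ᵀ)) χ₂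
    column : Fin ((k₁ + k₂) + n) → Fin (k₂ + (n + k₁))
    column = [ [ (λ b → k₂ ↑ʳ (n ↑ʳ b)) , _↑ˡ (n + k₁) ]′ ∘ splitAt k₁ , (λ p → k₂ ↑ʳ (p ↑ˡ k₁)) ]′
             ∘ splitAt (k₁ + k₂)
    column-crossing : ∀ b → column ((b ↑ˡ k₂) ↑ˡ n) ≡ k₂ ↑ʳ (n ↑ʳ b)
    column-crossing b rewrite splitAt-↑ˡ (k₁ + k₂) (b ↑ˡ k₂) n | splitAt-↑ˡ k₁ b k₂ = refl
    column-vertex : ∀ b → column ((k₁ ↑ʳ b) ↑ˡ n) ≡ b ↑ˡ (n + k₁)
    column-vertex b rewrite splitAt-↑ˡ (k₁ + k₂) (k₁ ↑ʳ b) n | splitAt-↑ʳ k₁ k₂ b = refl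
    column-port : ∀ p → column ((k₁ + k₂) ↑ʳ p) ≡ k₂ ↑ʳ (p ↑ˡ k₁)
    column-port p rewrite splitAt-↑ʳ (k₁ + k₂) n p = refl
    crossing : ∀ a b → boundaryMatrix G B χ (k₁ ↑ʳ a) ((b ↑ˡ k₂) ↑ˡ n) ≡ X₂ a (column ((b ↑ˡ k₂) ↑ˡ n))
    crossing a b = begin
      boundaryMatrix G B χ (k₁ ↑ʳ a) ((b ↑ˡ k₂) ↑ˡ n)
        ≡⟨ boundaryMatrix-vertex G B χ _ _ ⟩
      cutMatrix G χ (k₁ ↑ʳ a) (b ↑ˡ k₂)
        ≡⟨ cutMatrix-outside G χ _ (first≡false b) ⟩
      masked (χ₂ a) (G (k₁ ↑ʳ a) (b ↑ˡ k₂) + G (b ↑ˡ k₂) (k₁ ↑ʳ a))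
        ≡⟨ cong (masked (χ₂ a)) (trans (+-comm (G (k₁ ↑ʳ a) (b ↑ˡ k₂)) _)
                                       (trans (edges-between b a) (sym (beside-↑ʳ A₂ (C ᵀ) a b)))) ⟩
      masked (χ₂ a) (beside A₂ (C ᵀ) a (n ↑ʳ b))
        ≡⟨ boundaryMatrix-port G₂ (beside A₂ (C ᵀ)) χ₂ a (n ↑ʳ b) ⟨
      X₂ a (k₂ ↑ʳ (n ↑ʳ b))
        ≡⟨ cong (X₂ a) (column-crossing b) ⟨
      X₂ a (column ((b ↑ˡ k₂) ↑ˡ n)) ∎
    vertex : ∀ a b → boundaryMatrix G B χ (k₁ ↑ʳ a) ((k₁ ↑ʳ b) ↑ˡ n) ≡ X₂ a (column ((k₁ ↑ʳ b) ↑ˡ n))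
    vertex a b = begin
      boundaryMatrix G B χ (k₁ ↑ʳ a) ((k₁ ↑ʳ b) ↑ˡ n)
        ≡⟨ boundaryMatrix-vertex G B χ _ _ ⟩
      cutMatrix G χ (k₁ ↑ʳ a) (k₁ ↑ʳ b)
        ≡⟨ cutMatrix-cong {G = G} {G₂} {χ} {χ₂} refl refl (edges-second a b) ⟩
      cutMatrix G₂ χ₂ a b
        ≡⟨ boundaryMatrix-vertex G₂ (beside A₂ (C ᵀ)) χ₂ a b ⟨
      X₂ a (b ↑ˡ (n + k₁))
        ≡⟨ cong (X₂ a) (column-vertex b) ⟨
      X₂ a (column ((k₁ ↑ʳ b) ↑ˡ n)) ∎
    port : ∀ a p → boundaryMatrix G B χ (k₁ ↑ʳ a) ((k₁ + k₂) ↑ʳ p) ≡ X₂ a (column ((k₁ + k₂) ↑ʳ p))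
    port a p = begin
      boundaryMatrix G B χ (k₁ ↑ʳ a) ((k₁ + k₂) ↑ʳ p)
        ≡⟨ boundaryMatrix-port G B χ _ p ⟩
      masked (χ₂ a) (B (k₁ ↑ʳ a) p)
        ≡⟨ cong (masked (χ₂ a)) (trans (ports-second a p) (sym (beside-↑ˡ A₂ (C ᵀ) a p))) ⟩
      masked (χ₂ a) (beside A₂ (C ᵀ) a (p ↑ˡ k₁))
        ≡⟨ boundaryMatrix-port G₂ (beside A₂ (C ᵀ)) χ₂ a (p ↑ˡ k₁) ⟨
      X₂ a (k₂ ↑ʳ (p ↑ˡ k₁))
        ≡⟨ cong (X₂ a) (column-port p) ⟨
      X₂ a (column ((k₁ + k₂) ↑ʳ p)) ∎

module _ {k : ℕ} (R : RootedTree k) where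
  open RootedTree R using (tree; root; leafVertex)

  SideOf : Fin (SimpleGraph.size tree) → Fin (SimpleGraph.size tree) → (Fin k → Bool) → Set
  SideOf u v χ = ∀ i → (χ i ≡ true) ⇔ Walk tree (Avoiding tree u v) (leafVertex i) u

  RootedWidthLe : ∀ {n} → Mat ℕ k k → Mat ℕ k n → ℕ → Set
  RootedWidthLe G B w = ∀ u v → Edge tree u v → ∀ χ → SideOf u v χ →
                        ¬ Walk tree (Avoiding tree u v) root u → RankLe (boundaryMatrix G B χ) w

module JoinWidth {k : Side → ℕ} (R : (s : Side) → RootedTree (k s)) {n : ℕ}
                 {G : Mat ℕ (k first + k second) (k first + k second)} {B : Mat ℕ (k first + k second) n}
                 (G₁ : Mat ℕ (k first) (k first)) (G₂ : Mat ℕ (k second) (k second)) (C : Mat ℕ (k first) (k second))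
                 (A₁ : Mat ℕ (k first) n) (A₂ : Mat ℕ (k second) n)
                 (sameGraph : SameGraph G (upperBlock G₁ C G₂)) (stacked : ∀ i j → B i j ≡ stack A₁ A₂ i j) where
  open Join R
  open Blocks {G₁ = G₁} {G₂} {C} {A₁} {A₂} {G} {B} sameGraph stacked
  private
    module T (s : Side) = RootedTree (R s)

  Gs : ∀ s → Mat ℕ (k s) (k s)
  Gs first  = G₁
  Gs second = G₂

  Bs : ∀ s → Mat ℕ (k s) (n + k (other s))
  Bs first  = beside A₁ C
  Bs second = beside A₂ (C ᵀ)

  boundary-side : ∀ {w} s χ → (∀ i → χ (inject (other s) i) ≡ false) →
                  RankLe (boundaryMatrix (Gs s) (Bs s) (χ ∘ inject s)) w → RankLe (boundaryMatrix G B χ) w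
  boundary-side first  = boundary-first
  boundary-side second = boundary-second

  SideOf-inject : ∀ {U V χ} → SideOf joinedTree U V χ →
                  ∀ s i → (χ (inject s i) ≡ true) ⇔ Walk joined (Avoiding joined U V) (encode (inner s (T.leafVertex s i))) U
  SideOf-inject {U} {V} {χ} side s i =
    subst (λ x → (χ (inject s i) ≡ true) ⇔ Walk joined (Avoiding joined U V) x U) (leafVertex-inject s i) (side (inject s i))

  module _ {w : ℕ} (W : ∀ s → RootedWidthLe (R s) (Gs s) (Bs s) w) (top : ∀ s → RankLe (toℚ (Bs s)) w) where

    root-edge : ∀ s χ → SideOf joinedTree (encode (inner s (T.root s))) (encode new) χ → RankLe (boundaryMatrix G B χ) w
    root-edge s χ side = boundary-side s χ outside (RankLe-boundary-all (Gs s) (Bs s) (χ ∘ inject s) inside (top s))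
      where
      inside : ∀ i → χ (inject s i) ≡ true
      inside i = from (SideOf-inject side s i) (inner-walk s (λ _ → encode-inner≢new) _ _)
      outside : ∀ i → χ (inject (other s) i) ≡ false
      outside i = ¬-not λ χi → RootEdge-separates s (T.root s) (inSide-other s _) (to (SideOf-inject side (other s) i) χi)

    inner-edge : ∀ s {a b} → Edge (T.tree s) a b → ∀ χ → SideOf joinedTree (encode (inner s a)) (encode (inner s b)) χ →
                 ¬ Walk joined (Avoiding joined (encode (inner s a)) (encode (inner s b))) (encode new) (encode (inner s a)) →
                 RankLe (boundaryMatrix G B χ) w
    inner-edge s {a} {b} e χ side away = boundary-side s χ outside (W s a b e (χ ∘ inject s) side′ away′)
      where
      side′ : SideOf (R s) a b (χ ∘ inject s)
      side′ i = mk⇔ (project s ∘ to (SideOf-inject side s i)) (from (SideOf-inject side s i) ∘ lift s)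
      away′ : ¬ Walk (T.tree s) (Avoiding (T.tree s) a b) (T.root s) a
      away′ p = away (step (enter s encode-new≢inner encode-new≢inner) (lift s p))
      outside : ∀ i → χ (inject (other s) i) ≡ false
      outside i = ¬-not λ χi → away
        (step (enter (other s) encode-new≢inner encode-new≢inner)
              (inner-walk (other s) (λ _ → encode-other≢inner s) _ _ ++ʷ to (SideOf-inject side (other s) i) χi))

    join-width : RootedWidthLe joinedTree G B w
    join-width = Node-elim _ λ c → Node-elim _ λ d e → edge-case c d (edge-decode {c} {d} e)
      where
      edge-case : ∀ c d → adjN c d ≡ true → ∀ χ → SideOf joinedTree (encode c) (encode d) χ →
                  ¬ Walk joined (Avoiding joined (encode c) (encode d)) (encode new) (encode c) →
                  RankLe (boundaryMatrix G B χ) w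
      edge-case new d _ _ _ away = ⊥-elim (away here)
      edge-case (inner s a) new e χ side away with ≟-true⇒≡ {a = a} {T.root s} e
      ... | refl = root-edge s χ side
      edge-case (inner first a)  (inner first b)  e = inner-edge first e
      edge-case (inner second a) (inner second b) e = inner-edge second e
      edge-case (inner first a)  (inner second b) ()
      edge-case (inner second a) (inner first b)  ()

module _ {k : ℕ} (R : RootedTree k) where
  open RootedTree R using (tree; connected; acyclic; subcubic; root; leafVertex; leafVertex-isLeaf;
                           leafIndex; leafIndex-leafVertex; leafVertex-leafIndex)

  leaves : Leaf tree ⤖ Fin k
  leaves = mk⤖ {to = λ (x , p) → leafIndex x p}
               (injective , λ i → (leafVertex i , leafVertex-isLeaf i) , λ { refl → leafIndex-leafVertex i _ })
    where
    injective : ∀ {ℓ ℓ′ : Leaf tree} → leafIndex (proj₁ ℓ) _ ≡ leafIndex (proj₁ ℓ′) _ → ℓ ≡ ℓ′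
    injective {x , p} {x′ , p′} eq
      with trans (sym (leafVertex-leafIndex x p)) (trans (cong leafVertex eq) (leafVertex-leafIndex x′ p′))
    ... | refl = cong (x ,_) (≤-irrelevant p p′)

  rankDecomposition : (G : Mat ℕ k k) → RankDecomposition G
  rankDecomposition G = record { tree = tree ; isTree = connected , acyclic , subcubic ; r = leaves }

  SideOf-complement : ∀ {u v χ} → Edge tree u v → SideOf R u v χ → SideOf R v u (not ∘ χ)
  SideOf-complement {u} {v} {χ} e side i with χ i in χi
  ... | true  = mk⇔ (λ ()) (λ p → ⊥-elim (sides-disjoint acyclic e (to (side i) χi) (swapAvoided p)))
  ... | false = mk⇔ (λ _ → reach-v) (λ _ → refl)
    where
    reach-v : Walk tree (Avoiding tree v u) (leafVertex i) v
    reach-v with reaches-endpoint u v (connected (leafVertex i) u)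
    ... | inj₁ p = ⊥-elim (not-¬ χi (from (side i) p))
    ... | inj₂ q = swapAvoided q

  SideOf-leaves : ∀ {u v χ} →
                  (∀ (ℓ : Leaf tree) → (χ (Bijection.to leaves ℓ) ≡ true) ⇔ Walk tree (Avoiding tree u v) (proj₁ ℓ) u) →
                  SideOf R u v χ
  SideOf-leaves {χ = χ} leaf-side i =
    subst (λ j → (χ j ≡ true) ⇔ _) (leafIndex-leafVertex i _) (leaf-side (leafVertex i , leafVertex-isLeaf i))

  width : ∀ {n} {G : Mat ℕ k k} {B : Mat ℕ k n} {w} → RootedWidthLe R G B w → RDWidthLe (rankDecomposition G) w
  width {G = G} {B} W u v e χ leaf-side with reaches-endpoint u v (connected root u)
  ... | inj₂ root→v = RankLe-cut G B χ
          (W u v e χ (SideOf-leaves leaf-side) (λ root→u → sides-disjoint acyclic e root→u root→v))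
  ... | inj₁ root→u = RankLe-transpose (cutMatrix-complement G χ)
          (RankLe-cut G B (not ∘ χ) (W v u (Edge-sym {tree} e) (not ∘ χ) (SideOf-complement e (SideOf-leaves leaf-side))
                                        (λ root→v → sides-disjoint acyclic e root→u (swapAvoided root→v))))

IRDWidthLe-top : ∀ {k n G B w} (T : IRD (suc k) n G B) → IRDWidthLe T w → RankLe (toℚ B) w
IRDWidthLe-top leaf                     top           = top
IRDWidthLe-top (node _ _ _ _ _ _ _ _ _) (_ , _ , top) = top

rootedTree : ∀ {k n G B} (T : IRD (suc k) n G B) →
             Σ (RootedTree (suc k)) λ R → ∀ w → IRDWidthLe T w → RootedWidthLe R G B w
rootedTree leaf = singletonTree , λ _ _ _ _ ()
rootedTree {G = G} {B} (node {k₁} {k₂} G₁ G₂ C A₁ A₂ sameGraph stacked T₁ T₂) with rootedTree T₁ | rootedTree T₂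
... | R₁ , W₁ | R₂ , W₂ = Join.joinedTree R ,
      λ w (w₁ , w₂ , _) → JoinWidth.join-width R {G = G} {B} G₁ G₂ C A₁ A₂ sameGraph stacked
                            (λ { first → W₁ w w₁ ; second → W₂ w w₂ })
                            (λ { first → IRDWidthLe-top T₁ w₁ ; second → IRDWidthLe-top T₂ w₂ })
  where
  sizes : Side → ℕ
  sizes first  = suc k₁
  sizes second = suc k₂
  R : (s : Side) → RootedTree (sizes s)
  R first  = R₁
  R second = R₂

emptyDecomposition : (G : Mat ℕ 0 0) → RankDecomposition G
emptyDecomposition G = record
  { tree   = record { size = 0 ; adj = λ () ; sym = λ () ; irrefl = λ () }
  ; isTree = (λ ()) , (λ ()) , (λ ())
  ; r      = mk⤖ {to = λ { (() , _) }} ((λ { {() , _} }) , λ ())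
  }

nonemptyDecomposition : ∀ {k n G B} (T : IRD (suc k) n G B) →
                        Σ (RankDecomposition G) λ Y → ∀ w → IRDWidthLe T w → RDWidthLe Y w
nonemptyDecomposition {G = G} {B} T with rootedTree T
... | R , W = rankDecomposition R G , λ w h → width R {G = G} {B} (W w h)

proposition5p12 : ∀ {k n} {G : Mat ℕ k k} {B : Mat ℕ k n} (T : IRD k n G B) →
    Σ (RankDecomposition G) λ Y → ∀ w → IRDWidthLe T w → RDWidthLe Y w
proposition5p12 {G = G} empty              = emptyDecomposition G , λ _ _ ()
proposition5p12 T@leaf                     = nonemptyDecomposition T
proposition5p12 T@(node _ _ _ _ _ _ _ _ _) = nonemptyDecomposition T
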